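{- Let $0<\eta, \mu<1$. Then the following holds for all sufficiently large $k\in \mathbb{N}$. Let $R$ be a $k$-vertex multigraph with multiplicity $2$ (i.e. each pair of vertices is joined by $0$, $1$ or $2$ edges) and $\delta(R)\geq (1+\mu)k$, where degrees count a double-edge as two edges. Then there exists a $\{K^{=}_{2}, K_{3}\}$-tiling in $R$ which covers all but at most $\eta k$ vertices of $R$.
   Context: $K_2^{=}$ denotes a double-edge, i.e. two vertices joined by two parallel edges. A copy of $K_3$ in $R$ is a set of three vertices that are pairwise adjacent (by single- or double-edges). A $\{K^{=}_{2}, K_{3}\}$-tiling is a collection of vertex-disjoint subgraphs of $R$ each of which is a copy of $K_2^{=}$ or of $K_3$.
   Formalization: The parameters η and μ range over the rationals strictly between 0 and 1. -}

module Defs where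

open import Data.Nat using (ℕ; _≤_; _≥_)
open import Data.Fin using (Fin)
open import Data.List using (List; []; _∷_; _++_; concatMap; length; map; allFin)
open import Data.Nat.ListAction using (sum)
open import Data.List.Relation.Unary.All using (All)
open import Data.List.Relation.Unary.Unique.Propositional using (Unique)
open import Data.Product using (_×_)
open import Relation.Binary.PropositionalEquality using (_≡_; _≢_)
open import Data.Integer using (+_)
open import Data.Rational using (ℚ; _/_)

ℕtoℚ : ℕ → ℚ
ℕtoℚ n = + n / 1

-- A multigraph with multiplicity 2 on vertex set Fin k (loopless):
-- mult u v = number of edges joining u and v (0, 1 or 2).
record MultiGraph2 (k : ℕ) : Set where
  field
    mult     : Fin k → Fin k → ℕ
    mult-sym : ∀ u v → mult u v ≡ mult v u
    loopless : ∀ v → mult v v ≡ 0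
    mult≤2   : ∀ u v → mult u v ≤ 2
open MultiGraph2 public

degree : ∀ {k} → MultiGraph2 k → Fin k → ℕ
degree {k} R v = sum (map (mult R v) (allFin k))

MinDegreeAtLeast : ∀ {k} → MultiGraph2 k → ℚ → Set
MinDegreeAtLeast {k} R x = ∀ v → x Data.Rational.≤ ℕtoℚ (degree R v)

data Tile (k : ℕ) : Set where
  double   : Fin k → Fin k → Tile k
  triangle : Fin k → Fin k → Fin k → Tile k

tileVertices : ∀ {k} → Tile k → List (Fin k)
tileVertices (double u v)     = u ∷ v ∷ []
tileVertices (triangle a b c) = a ∷ b ∷ c ∷ []

IsTileIn : ∀ {k} → MultiGraph2 k → Tile k → Set
IsTileIn R (double u v)     = u ≢ v × mult R u v ≡ 2
IsTileIn R (triangle a b c) =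
  (a ≢ b × b ≢ c × a ≢ c) ×
  (1 ≤ mult R a b × 1 ≤ mult R b c × 1 ≤ mult R a c)

record Tiling {k : ℕ} (R : MultiGraph2 k) : Set where
  field
    tiles    : List (Tile k)
    valid    : All (IsTileIn R) tiles
    disjoint : Unique (concatMap tileVertices tiles)
open Tiling public

coveredVertices : ∀ {k} {R : MultiGraph2 k} → Tiling R → List (Fin k)
coveredVertices T = concatMap tileVertices (tiles T)

-- We prove more: if every degree exceeds k, some tiling leaves at most 3 vertices uncovered.  Let a tiling cover C and leave U, with |U| ≥ 4.
-- If U spans a double edge, add it.  Otherwise each vertex of U sends at most |U| edges
-- into U, so, as all degrees exceed k = |C| + |U|, the vertices of U send more than |U|·|C|
-- edges into C and some tile t receives more than |U|·|t| of them.  If t is a double edge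
-- ab, some x ∈ U sends at least 3 edges to it and xab is a triangle.  If t is a triangle,
-- some x ∈ U sends at least 4 edges to it and another y ∈ U at least 3 (each sends at most
-- 6 and |U| ≥ 4); then x has a double edge to some p ∈ t, and two disjoint tiles cover four
-- or five of x, y and t.  Either way the tiling grows.  Finally k₀ is chosen with η·k₀ ≥ 3.

module Submission where

open import Defs

module Tilings where

  open import Data.Nat using (ℕ; zero; suc; _+_; _≤_; _<_; z≤n; s≤s; s≤s⁻¹; z<s)
  open import Data.Nat.Properties
  open import Algebra.Properties.CommutativeSemigroup +-commutativeSemigroup
    using (interchange; x∙yz≈y∙xz)
  open import Data.Nat.ListAction using (sum)
  open import Data.Nat.ListAction.Properties using (sum-++; sum-↭)
  open import Data.Fin using (Fin)
  import Data.Fin as Fin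
  open import Data.List using (List; []; _∷_; _++_; [_]; map; concatMap; filter; length; allFin)
  open import Data.List.Properties using (map-++; map-cong; concatMap-++; length-++; length-tabulate)
  open import Data.List.Relation.Unary.All as All using (All; []; _∷_)
  open import Data.List.Relation.Unary.Any using (Any; here; there; any?)
  open import Data.List.Relation.Unary.All.Properties as All using (¬Any⇒All¬)
  open import Data.List.Relation.Unary.AllPairs using ([]; _∷_)
  open import Data.List.Relation.Unary.Unique.Propositional using (Unique)
  import Data.List.Relation.Unary.Unique.Propositional.Properties as Unique
  open import Data.List.Membership.Propositional using (_∈_; _∉_; find; lose)
  open import Data.List.Membership.Propositional.Properties
    using (∈-++⁺ˡ; ∈-++⁺ʳ; ∈-++⁻; ∈-∃++; ∈-filter⁺; ∈-filter⁻; ∈-allFin; ∈-concatMap⁺)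
  open import Data.List.Membership.Propositional.Properties.WithK using (unique∧set⇒bag)
  open import Data.List.Relation.Binary.BagAndSetEquality using (∼bag⇒↭)
  open import Data.List.Relation.Binary.Permutation.Propositional using (_↭_; ↭-sym; ↭⇒↭ₛ)
  open import Data.List.Relation.Binary.Permutation.Propositional.Properties
    using (map⁺; ↭-length; shift; shifts; ∈-resp-↭; All-resp-↭)
  import Data.List.Relation.Binary.Permutation.Setoid.Properties as PermutationSetoid
  open import Data.List.Relation.Binary.Subset.Propositional using (_⊆_)
  open import Data.Product using (Σ; ∃; ∃₂; _×_; _,_; proj₁; proj₂)
  open import Data.Sum as Sum using (_⊎_; inj₁; inj₂)
  open import Data.Empty using (⊥; ⊥-elim)
  open import Function using (id; _∘_; mk⇔)
  open import Relation.Nullary using (yes; no; ¬?; contradiction)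
  open import Relation.Binary.Definitions using (DecidableEquality)
  open import Relation.Binary.PropositionalEquality hiding ([_])

  private variable
    A B : Set

  sum-map-++ : ∀ (f : A → ℕ) xs ys → sum (map f (xs ++ ys)) ≡ sum (map f xs) + sum (map f ys)
  sum-map-++ f xs ys = trans (cong sum (map-++ f xs ys)) (sum-++ (map f xs) (map f ys))

  sum-map-+ : ∀ (f g : A → ℕ) xs →
    sum (map (λ x → f x + g x) xs) ≡ sum (map f xs) + sum (map g xs)
  sum-map-+ f g []       = refl
  sum-map-+ f g (x ∷ xs) =
    trans (cong (f x + g x +_) (sum-map-+ f g xs)) (interchange (f x) (g x) _ _)

  sum-map-suc : ∀ (f : A → ℕ) xs → sum (map (λ x → suc (f x)) xs) ≡ length xs + sum (map f xs)
  sum-map-suc f []       = refl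
  sum-map-suc f (x ∷ xs) =
    cong suc (trans (cong (f x +_) (sum-map-suc f xs)) (x∙yz≈y∙xz (f x) (length xs) _))

  sum-map-0 : ∀ (xs : List A) → sum (map (λ _ → 0) xs) ≡ 0
  sum-map-0 []       = refl
  sum-map-0 (x ∷ xs) = sum-map-0 xs

  sum-map-1 : ∀ (xs : List A) → sum (map (λ _ → 1) xs) ≡ length xs
  sum-map-1 []       = refl
  sum-map-1 (x ∷ xs) = cong suc (sum-map-1 xs)

  sum-map-triple : ∀ (f : A → ℕ) a b c → sum (map f (a ∷ b ∷ c ∷ [])) ≡ f a + (f b + f c)
  sum-map-triple f a b c = cong (λ s → f a + (f b + s)) (+-identityʳ (f c))

  sum-map-mono : ∀ {f g : A → ℕ} {xs} → All (λ x → f x ≤ g x) xs →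
    sum (map f xs) ≤ sum (map g xs)
  sum-map-mono []         = z≤n
  sum-map-mono (fx≤gx ∷ p) = +-mono-≤ fx≤gx (sum-map-mono p)

  sum-map-↭ : ∀ (f : A → ℕ) {xs ys} → xs ↭ ys → sum (map f xs) ≡ sum (map f ys)
  sum-map-↭ f xs↭ys = sum-↭ (map⁺ f xs↭ys)

  Unique-resp-↭ : ∀ {xs ys : List A} → xs ↭ ys → Unique xs → Unique ys
  Unique-resp-↭ xs↭ys = PermutationSetoid.Unique-resp-↭ (setoid _) (↭⇒↭ₛ xs↭ys)

  Unique-++⁻ʳ : ∀ (xs : List A) {ys} → Unique (xs ++ ys) → Unique ys
  Unique-++⁻ʳ []       ys!           = ys!
  Unique-++⁻ʳ (_ ∷ xs) (_ ∷ xs++ys!) = Unique-++⁻ʳ xs xs++ys!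

  Unique-++⇒∉ : ∀ (xs : List A) {ys v} → Unique (xs ++ ys) → v ∈ xs → v ∉ ys
  Unique-++⇒∉ (_ ∷ xs) (x∉xs++ys ∷ _) (here refl) v∈ys = All.lookup x∉xs++ys (∈-++⁺ʳ xs v∈ys) refl
  Unique-++⇒∉ (_ ∷ xs) (_ ∷ xs++ys!)  (there v∈xs) = Unique-++⇒∉ xs xs++ys! v∈xs

  Unique-replaceˡ : ∀ {xs ys zs : List A} → Unique (ys ++ zs) → Unique xs →
    All (λ v → v ∈ ys ⊎ v ∉ ys ++ zs) xs → Unique (xs ++ zs)
  Unique-replaceˡ {xs = xs} {ys = ys} {zs = zs} ys++zs! xs! xs⊆ys∪fresh =
    Unique.++⁺ xs! (Unique-++⁻ʳ ys ys++zs!) xs#zs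
    where
    xs#zs : ∀ {v} → v ∈ xs × v ∈ zs → ⊥
    xs#zs (v∈xs , v∈zs) with All.lookup xs⊆ys∪fresh v∈xs
    ... | inj₁ v∈ys     = Unique-++⇒∉ ys ys++zs! v∈ys v∈zs
    ... | inj₂ v∉ys++zs = v∉ys++zs (∈-++⁺ʳ ys v∈zs)

  ∉∧∈⇒≢ : ∀ {x v : A} {C} → x ∉ C → v ∈ C → x ≢ v
  ∉∧∈⇒≢ x∉C v∈C refl = x∉C v∈C

  pigeonhole : ∀ (f g : A → ℕ) xs → sum (map f xs) < sum (map g xs) → Any (λ x → f x < g x) xs
  pigeonhole f g (x ∷ xs) Σf<Σg with f x <? g x
  ... | yes fx<gx = here fx<gx
  ... | no  fx≮gx = there (pigeonhole f g xs (+-cancelˡ-< (g x) _ _ (begin-strict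
    g x + sum (map f xs) ≤⟨ +-monoˡ-≤ _ (≮⇒≥ fx≮gx) ⟩
    f x + sum (map f xs) <⟨ Σf<Σg ⟩
    g x + sum (map g xs) ∎)))
    where open ≤-Reasoning

  pigeonhole-∷ : ∀ c (f : A → ℕ) x xs → f x ≤ c + suc (length xs) →
    sum (map (λ _ → suc c) (x ∷ xs)) < sum (map f (x ∷ xs)) → Any (λ y → c < f y) xs
  pigeonhole-∷ c f x xs fx≤ Σ< =
    pigeonhole (λ _ → c) f xs (+-cancelˡ-< (c + suc (length xs)) _ _ (begin-strict
    c + suc (length xs) + sum (map (λ _ → c) xs)   ≡⟨ cong (_+ sum (map (λ _ → c) xs)) (+-suc c _) ⟩
    suc c + length xs + sum (map (λ _ → c) xs)     ≡⟨ +-assoc (suc c) (length xs) _ ⟩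
    suc c + (length xs + sum (map (λ _ → c) xs))   ≡⟨ cong (suc c +_) (sum-map-suc (λ _ → c) xs) ⟨
    suc c + sum (map (λ _ → suc c) xs)             <⟨ Σ< ⟩
    f x + sum (map f xs)                           ≤⟨ +-monoˡ-≤ _ fx≤ ⟩
    c + suc (length xs) + sum (map f xs)           ∎))
    where open ≤-Reasoning

  pigeonhole₂ : ∀ c (f : A → ℕ) {xs} → Unique xs → (∀ x → f x ≤ c + length xs) →
    sum (map (λ _ → suc c) xs) < sum (map f xs) →
    ∃₂ λ x y → x ∈ xs × y ∈ xs × x ≢ y × suc c < f x × c < f y
  pigeonhole₂ c f {xs} xs! f≤c+∣xs∣ Σ< with find (pigeonhole (λ _ → suc c) f xs Σ<)
  ... | x , x∈xs , c+1<fx with ∈-∃++ x∈xs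
  ... | ys , zs , refl = withSecond (find (pigeonhole-∷ c f x (ys ++ zs) fx≤ Σ′<))
    where
    xs↭ = shift x ys zs
    fx≤ = subst (λ n → f x ≤ c + n) (↭-length xs↭) (f≤c+∣xs∣ x)
    Σ′< = subst₂ _<_ (sum-map-↭ _ xs↭) (sum-map-↭ f xs↭) Σ<
    withSecond : (∃ λ y → y ∈ ys ++ zs × c < f y) → _
    withSecond (y , y∈rest , c<fy) =
      x , y , x∈xs , ∈-resp-↭ (↭-sym xs↭) (there y∈rest) , x≢y , c+1<fx , c<fy
      where
      x≢y : x ≢ y
      x≢y refl = Unique.Unique[x∷xs]⇒x∉xs (Unique-resp-↭ xs↭ xs!) y∈rest

  module _ {A : Set} (_≟_ : DecidableEquality A) where
    open import Data.List.Membership.DecPropositional _≟_ using (_∈?_)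

    complement : List A → List A → List A
    complement ys xs = filter (λ x → ¬? (x ∈? ys)) xs

    ∈-complement⁻ : ∀ {x} ys xs → x ∈ complement ys xs → x ∈ xs × x ∉ ys
    ∈-complement⁻ ys xs = ∈-filter⁻ (λ x → ¬? (x ∈? ys))

    ↭-++-complement : ∀ {xs ys} → Unique xs → Unique ys → ys ⊆ xs → xs ↭ ys ++ complement ys xs
    ↭-++-complement {xs} {ys} xs! ys! ys⊆xs =
      ∼bag⇒↭ (unique∧set⇒bag xs! (Unique.++⁺ ys! (Unique.filter⁺ _ xs!) ys#rest) (mk⇔ to from))
      where
      ys#rest : ∀ {x} → x ∈ ys × x ∈ complement ys xs → ⊥
      ys#rest (x∈ys , x∈rest) = proj₂ (∈-complement⁻ ys xs x∈rest) x∈ys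
      to : ∀ {x} → x ∈ xs → x ∈ ys ++ complement ys xs
      to {x} x∈xs with x ∈? ys
      ... | yes x∈ys = ∈-++⁺ˡ x∈ys
      ... | no  x∉ys = ∈-++⁺ʳ ys (∈-filter⁺ (λ x → ¬? (x ∈? ys)) x∈xs x∉ys)
      from : ∀ {x} → x ∈ ys ++ complement ys xs → x ∈ xs
      from x∈ with ∈-++⁻ ys x∈
      ... | inj₁ x∈ys  = ys⊆xs x∈ys
      ... | inj₂ x∈rest = proj₁ (∈-complement⁻ ys xs x∈rest)

  ∑∑ : (A → B → ℕ) → List A → List B → ℕ
  ∑∑ w xs ys = sum (map (λ x → sum (map (w x) ys)) xs)

  ∑∑-++ʳ : ∀ (w : A → B → ℕ) xs ys zs → ∑∑ w xs (ys ++ zs) ≡ ∑∑ w xs ys + ∑∑ w xs zs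
  ∑∑-++ʳ w xs ys zs =
    trans (cong sum (map-cong (λ x → sum-map-++ (w x) ys zs) xs)) (sum-map-+ _ _ xs)

  ∑∑-↭ʳ : ∀ (w : A → B → ℕ) xs {ys zs} → ys ↭ zs → ∑∑ w xs ys ≡ ∑∑ w xs zs
  ∑∑-↭ʳ w xs ys↭zs = cong sum (map-cong (λ x → sum-map-↭ (w x) ys↭zs) xs)

  ∑∑-concatMapʳ : ∀ {C : Set} (w : A → B → ℕ) xs (g : C → List B) zs →
    ∑∑ w xs (concatMap g zs) ≡ sum (map (λ z → ∑∑ w xs (g z)) zs)
  ∑∑-concatMapʳ w xs g []       = sum-map-0 xs
  ∑∑-concatMapʳ w xs g (z ∷ zs) =
    trans (∑∑-++ʳ w xs (g z) (concatMap g zs)) (cong (∑∑ w xs (g z) +_) (∑∑-concatMapʳ w xs g zs))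

  ∑∑-mono : ∀ {w w′ : A → B → ℕ} {xs ys} → All (λ x → All (λ y → w x y ≤ w′ x y) ys) xs →
    ∑∑ w xs ys ≤ ∑∑ w′ xs ys
  ∑∑-mono w≤w′ = sum-map-mono (All.map sum-map-mono w≤w′)

  positive-summands : ∀ {a b n} → a ≤ n → b ≤ n → n < a + b → 0 < a × 0 < b
  positive-summands {zero}             _   b≤n n<b   = ⊥-elim (<⇒≱ n<b b≤n)
  positive-summands {suc a} {zero} {n} a≤n _   n<a+0 =
    ⊥-elim (<⇒≱ (subst (n <_) (+-identityʳ (suc a)) n<a+0) a≤n)
  positive-summands {suc _} {suc _}    _   _   _     = z<s , z<s

  ≤2∧≢2⇒≤1 : ∀ {a} → a ≤ 2 → a ≢ 2 → a ≤ 1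
  ≤2∧≢2⇒≤1 a≤2 a≢2 = s≤s⁻¹ (≤∧≢⇒< a≤2 a≢2)

  some-summand≡2 : ∀ {a b c} → a ≤ 2 → b ≤ 2 → c ≤ 2 → 3 < a + (b + c) → a ≡ 2 ⊎ b ≡ 2 ⊎ c ≡ 2
  some-summand≡2 {a} {b} {c} a≤2 b≤2 c≤2 3<a+b+c with a ≟ 2 | b ≟ 2 | c ≟ 2
  ... | yes a≡2 | _       | _       = inj₁ a≡2
  ... | no _    | yes b≡2 | _       = inj₂ (inj₁ b≡2)
  ... | no _    | no _    | yes c≡2 = inj₂ (inj₂ c≡2)
  ... | no a≢2  | no b≢2  | no c≢2  = ⊥-elim (<⇒≱ 3<a+b+c
    (+-mono-≤ (≤2∧≢2⇒≤1 a≤2 a≢2) (+-mono-≤ (≤2∧≢2⇒≤1 b≤2 b≢2) (≤2∧≢2⇒≤1 c≤2 c≢2))))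

  first-summand≡2 : ∀ {a s} → a ≤ 2 → s ≤ 1 → 2 < a + s → a ≡ 2
  first-summand≡2 z≤n               s≤1 2<s   = ⊥-elim (<⇒≱ 2<s (≤-trans s≤1 (s≤s z≤n)))
  first-summand≡2 (s≤s z≤n)         s≤1 2<1+s = ⊥-elim (<⇒≱ 2<1+s (s≤s s≤1))
  first-summand≡2 (s≤s (s≤s z≤n))   _   _     = refl

  vertices : ∀ {k} → List (Tile k) → List (Fin k)
  vertices = concatMap tileVertices

  vertices-++ : ∀ {k} (ts us : List (Tile k)) → vertices (ts ++ us) ≡ vertices ts ++ vertices us
  vertices-++ = concatMap-++ tileVertices

  module _ {k : ℕ} (R : MultiGraph2 k) where

    record Retiling (B C : List (Fin k)) : Set where
      field
        newTiles    : List (Tile k)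
        newValid    : All (IsTileIn R) newTiles
        newDisjoint : Unique (vertices newTiles)
        newVertices : All (λ v → v ∈ B ⊎ v ∉ C) (vertices newTiles)
        grows       : length B < length (vertices newTiles)

    retile : (T : Tiling R) (P S Q : List (Tile k)) → tiles T ≡ P ++ S ++ Q →
      Retiling (vertices S) (coveredVertices T) →
      Σ (Tiling R) λ T′ → length (coveredVertices T) < length (coveredVertices T′)
    retile record { valid = PSQ-valid ; disjoint = PSQ! } P S Q refl N =
      record { tiles = newTiles ++ P ++ Q ; valid = valid′ ; disjoint = disjoint′ } , longer
      where
      open Retiling N
      rest = vertices (P ++ Q)
      covered↭ : vertices (P ++ S ++ Q) ↭ vertices S ++ rest
      covered↭ = subst₂ _↭_
        (sym (trans (vertices-++ P (S ++ Q)) (cong (vertices P ++_) (vertices-++ S Q))))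
        (cong (vertices S ++_) (sym (vertices-++ P Q)))
        (shifts (vertices P) (vertices S))
      valid′ : All (IsTileIn R) (newTiles ++ P ++ Q)
      valid′ = All.++⁺ newValid (All.++⁻ʳ S (All-resp-↭ (shifts P S) PSQ-valid))
      disjoint′ : Unique (vertices (newTiles ++ P ++ Q))
      disjoint′ = subst Unique (sym (vertices-++ newTiles (P ++ Q)))
        (Unique-replaceˡ (Unique-resp-↭ covered↭ PSQ!) newDisjoint
          (All.map (Sum.map₂ (_∘ ∈-resp-↭ (↭-sym covered↭))) newVertices))
      longer : length (vertices (P ++ S ++ Q)) < length (vertices (newTiles ++ P ++ Q))
      longer = begin-strict
        length (vertices (P ++ S ++ Q))              ≡⟨ ↭-length covered↭ ⟩
        length (vertices S ++ rest)                  ≡⟨ length-++ (vertices S) ⟩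
        length (vertices S) + length rest            <⟨ +-monoˡ-< (length rest) grows ⟩
        length (vertices newTiles) + length rest     ≡⟨ length-++ (vertices newTiles) ⟨
        length (vertices newTiles ++ rest)           ≡⟨ cong length (vertices-++ newTiles (P ++ Q)) ⟨
        length (vertices (newTiles ++ P ++ Q))       ∎
        where open ≤-Reasoning

    rotate : ∀ {a b c} → IsTileIn R (triangle a b c) → IsTileIn R (triangle b c a)
    rotate {a} {b} {c} ((a≢b , b≢c , a≢c) , (ab , bc , ac)) =
      (b≢c , ≢-sym a≢c , ≢-sym a≢b) ,
      (bc , subst (1 ≤_) (mult-sym R a c) ac , subst (1 ≤_) (mult-sym R a b) ab)

    module _ {B C : List (Fin k)} (B⊆C : B ⊆ C) (∣B∣≤3 : length B ≤ 3) where

      twoDoubleEdges : ∀ {z w p q} → z ∉ C → w ∉ C → z ≢ w → p ∈ B → q ∈ B → p ≢ q →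
        mult R z p ≡ 2 → mult R w q ≡ 2 → Retiling B C
      twoDoubleEdges z∉C w∉C z≢w p∈B q∈B p≢q zp wq = record
        { newTiles    = double _ _ ∷ double _ _ ∷ []
        ; newValid    = (z≢p , zp) ∷ (w≢q , wq) ∷ []
        ; newDisjoint = (z≢p ∷ z≢w ∷ z≢q ∷ []) ∷ (≢-sym w≢p ∷ p≢q ∷ []) ∷ (w≢q ∷ []) ∷ [] ∷ []
        ; newVertices = inj₂ z∉C ∷ inj₁ p∈B ∷ inj₂ w∉C ∷ inj₁ q∈B ∷ []
        ; grows       = s≤s ∣B∣≤3 }
        where
        z≢p = ∉∧∈⇒≢ z∉C (B⊆C p∈B)
        z≢q = ∉∧∈⇒≢ z∉C (B⊆C q∈B)
        w≢p = ∉∧∈⇒≢ w∉C (B⊆C p∈B)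
        w≢q = ∉∧∈⇒≢ w∉C (B⊆C q∈B)

      doubleEdgeAndTriangle : ∀ {z w p q r} → z ∉ C → w ∉ C → z ≢ w → p ∈ B → q ∈ B → r ∈ B →
        IsTileIn R (triangle p q r) → mult R z p ≡ 2 → 0 < mult R w q → 0 < mult R w r → Retiling B C
      doubleEdgeAndTriangle z∉C w∉C z≢w p∈B q∈B r∈B ((p≢q , q≢r , p≢r) , (_ , qr , _)) zp wq wr =
        record
        { newTiles    = double _ _ ∷ triangle _ _ _ ∷ []
        ; newValid    = (z≢p , zp) ∷ ((w≢q , q≢r , w≢r) , (wq , qr , wr)) ∷ []
        ; newDisjoint = (z≢p ∷ z≢w ∷ z≢q ∷ z≢r ∷ []) ∷ (≢-sym w≢p ∷ p≢q ∷ p≢r ∷ [])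
                        ∷ (w≢q ∷ w≢r ∷ []) ∷ (q≢r ∷ []) ∷ [] ∷ []
        ; newVertices = inj₂ z∉C ∷ inj₁ p∈B ∷ inj₂ w∉C ∷ inj₁ q∈B ∷ inj₁ r∈B ∷ []
        ; grows       = s≤s (m≤n⇒m≤1+n ∣B∣≤3) }
        where
        z≢p = ∉∧∈⇒≢ z∉C (B⊆C p∈B)
        z≢q = ∉∧∈⇒≢ z∉C (B⊆C q∈B)
        z≢r = ∉∧∈⇒≢ z∉C (B⊆C r∈B)
        w≢p = ∉∧∈⇒≢ w∉C (B⊆C p∈B)
        w≢q = ∉∧∈⇒≢ w∉C (B⊆C q∈B)
        w≢r = ∉∧∈⇒≢ w∉C (B⊆C r∈B)

      doubleEdgeAndPair : ∀ {z w p q r} → z ∉ C → w ∉ C → z ≢ w → p ∈ B → q ∈ B → r ∈ B →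
        IsTileIn R (triangle p q r) → mult R z p ≡ 2 → 2 ≤ mult R w q + mult R w r → Retiling B C
      doubleEdgeAndPair {w = w} {q = q} {r} z∉C w∉C z≢w p∈B q∈B r∈B pqr@((p≢q , _ , p≢r) , _) zp
        2≤wq+wr with mult R w q ≟ 2 | mult R w r ≟ 2
      ... | yes wq    | _         = twoDoubleEdges z∉C w∉C z≢w p∈B q∈B p≢q zp wq
      ... | no _      | yes wr    = twoDoubleEdges z∉C w∉C z≢w p∈B r∈B p≢r zp wr
      ... | no wq≢2   | no wr≢2   = doubleEdgeAndTriangle z∉C w∉C z≢w p∈B q∈B r∈B pqr zp 0<wq 0<wr
        where
        0<wq,0<wr = positive-summands
          (≤2∧≢2⇒≤1 (mult≤2 R w q) wq≢2) (≤2∧≢2⇒≤1 (mult≤2 R w r) wr≢2) 2≤wq+wr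
        0<wq = proj₁ 0<wq,0<wr
        0<wr = proj₂ 0<wq,0<wr

      retileTriangleFromDouble : ∀ {x y p q r} → x ∉ C → y ∉ C → x ≢ y → p ∈ B → q ∈ B → r ∈ B →
        IsTileIn R (triangle p q r) → mult R x p ≡ 2 →
        3 < mult R x p + (mult R x q + mult R x r) → 2 < mult R y p + (mult R y q + mult R y r) →
        Retiling B C
      retileTriangleFromDouble {x} {y} {p} {q} {r} x∉C y∉C x≢y p∈B q∈B r∈B pqr xp 3<x 2<y
        with 2 ≤? mult R y q + mult R y r
      ... | yes 2≤yq+yr = doubleEdgeAndPair x∉C y∉C x≢y p∈B q∈B r∈B pqr xp 2≤yq+yr
      -- otherwise y has a double edge to p and the roles of x and y swap
      ... | no  2≰yq+yr = doubleEdgeAndPair y∉C x∉C (≢-sym x≢y) p∈B q∈B r∈B pqr yp 2≤xq+xr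
        where
        yp = first-summand≡2 (mult≤2 R y p) (s≤s⁻¹ (≰⇒> 2≰yq+yr)) 2<y
        2≤xq+xr = s≤s⁻¹ (s≤s⁻¹ (subst (λ a → 3 < a + (mult R x q + mult R x r)) xp 3<x))

    retileTriangle : ∀ {C a b c x y} → (a ∷ b ∷ c ∷ []) ⊆ C → x ∉ C → y ∉ C → x ≢ y →
      IsTileIn R (triangle a b c) →
      3 < mult R x a + (mult R x b + mult R x c) → 2 < mult R y a + (mult R y b + mult R y c) →
      Retiling (a ∷ b ∷ c ∷ []) C
    retileTriangle {a = a} {b} {c} {x} {y} abc⊆C x∉C y∉C x≢y abc 3<x 2<y =
      fromDoubleEdge (some-summand≡2 (mult≤2 R x a) (mult≤2 R x b) (mult≤2 R x c) 3<x)
      where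
      a∈ = here refl
      b∈ = there (here refl)
      c∈ = there (there (here refl))
      rotate-< : ∀ {n} z p q r → n < mult R z p + (mult R z q + mult R z r) →
        n < mult R z q + (mult R z r + mult R z p)
      rotate-< {n} z p q r =
        subst (n <_) (trans (+-comm (mult R z p) _) (+-assoc (mult R z q) (mult R z r) (mult R z p)))
      fromDoubleEdge : mult R x a ≡ 2 ⊎ mult R x b ≡ 2 ⊎ mult R x c ≡ 2 → Retiling (a ∷ b ∷ c ∷ []) _
      fromDoubleEdge (inj₁ xa)        =
        retileTriangleFromDouble abc⊆C ≤-refl x∉C y∉C x≢y a∈ b∈ c∈ abc xa 3<x 2<y
      fromDoubleEdge (inj₂ (inj₁ xb)) =
        retileTriangleFromDouble abc⊆C ≤-refl x∉C y∉C x≢y b∈ c∈ a∈ (rotate abc) xb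
          (rotate-< x a b c 3<x) (rotate-< y a b c 2<y)
      fromDoubleEdge (inj₂ (inj₂ xc)) =
        retileTriangleFromDouble abc⊆C ≤-refl x∉C y∉C x≢y c∈ a∈ b∈ (rotate (rotate abc)) xc
          (rotate-< x b c a (rotate-< x a b c 3<x)) (rotate-< y b c a (rotate-< y a b c 2<y))

    Heavy : List (Fin k) → List (Fin k) → Set
    Heavy U B = ∑∑ (λ _ _ → 1) U B < ∑∑ (mult R) U B

    module _ {C U : List (Fin k)} (U∩C=∅ : ∀ {x} → x ∈ U → x ∉ C) where

      addDoubleEdge : ∀ {x v} → x ∈ U → v ∈ U → mult R x v ≡ 2 → Retiling [] C
      addDoubleEdge {x} {v} x∈U v∈U xv = record
        { newTiles    = double x v ∷ []
        ; newValid    = (x≢v , xv) ∷ []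
        ; newDisjoint = (x≢v ∷ []) ∷ [] ∷ []
        ; newVertices = inj₂ (U∩C=∅ x∈U) ∷ inj₂ (U∩C=∅ v∈U) ∷ []
        ; grows       = z<s }
        where
        x≢v : x ≢ v
        x≢v refl = contradiction (trans (sym (loopless R x)) xv) λ ()

      retileHeavyDouble : ∀ {a b} → IsTileIn R (double a b) → (a ∷ b ∷ []) ⊆ C →
        Heavy U (a ∷ b ∷ []) → Retiling (a ∷ b ∷ []) C
      retileHeavyDouble {a} {b} (a≢b , ab) ab⊆C heavy with find (pigeonhole _ _ U heavy)
      ... | x , x∈U , 2<xa+xb = record
        { newTiles    = triangle x a b ∷ []
        ; newValid    = ((x≢a , a≢b , x≢b) ,
                         (proj₁ 0<xa,0<xb , subst (0 <_) (sym ab) z<s , proj₂ 0<xa,0<xb)) ∷ []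
        ; newDisjoint = (x≢a ∷ x≢b ∷ []) ∷ (a≢b ∷ []) ∷ [] ∷ []
        ; newVertices = inj₂ x∉C ∷ inj₁ (here refl) ∷ inj₁ (there (here refl)) ∷ []
        ; grows       = ≤-refl }
        where
        x∉C = U∩C=∅ x∈U
        x≢a = ∉∧∈⇒≢ x∉C (ab⊆C (here refl))
        x≢b = ∉∧∈⇒≢ x∉C (ab⊆C (there (here refl)))
        0<xa,0<xb = positive-summands (mult≤2 R x a) (mult≤2 R x b)
          (subst (λ s → 2 < mult R x a + s) (+-identityʳ _) 2<xa+xb)

      retileHeavyTriangle : ∀ {a b c} → Unique U → 4 ≤ length U → IsTileIn R (triangle a b c) →
        (a ∷ b ∷ c ∷ []) ⊆ C → Heavy U (a ∷ b ∷ c ∷ []) → Retiling (a ∷ b ∷ c ∷ []) C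
      retileHeavyTriangle {a} {b} {c} U! 4≤∣U∣ abc abc⊆C heavy
        with pigeonhole₂ 2 (λ z → sum (map (mult R z) (a ∷ b ∷ c ∷ []))) U! r≤2+∣U∣ heavy
        where
        r≤2+∣U∣ : ∀ z → sum (map (mult R z) (a ∷ b ∷ c ∷ [])) ≤ 2 + length U
        r≤2+∣U∣ z = ≤-trans
          (+-mono-≤ (mult≤2 R z a) (+-mono-≤ (mult≤2 R z b) (+-mono-≤ (mult≤2 R z c) z≤n)))
          (+-monoʳ-≤ 2 4≤∣U∣)
      ... | x , y , x∈U , y∈U , x≢y , 3<x , 2<y =
        retileTriangle abc⊆C (U∩C=∅ x∈U) (U∩C=∅ y∈U) x≢y abc
          (subst (3 <_) (sum-map-triple (mult R x) a b c) 3<x)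
          (subst (2 <_) (sum-map-triple (mult R y) a b c) 2<y)

      retileHeavyTile : Unique U → 4 ≤ length U → (t : Tile k) → IsTileIn R t →
        tileVertices t ⊆ C → Heavy U (tileVertices t) → Retiling (vertices [ t ]) C
      retileHeavyTile _  _      (double _ _)     = retileHeavyDouble
      retileHeavyTile U! 4≤∣U∣  (triangle _ _ _) = retileHeavyTriangle U! 4≤∣U∣

    uncovered : Tiling R → List (Fin k)
    uncovered T = complement Fin._≟_ (coveredVertices T) (allFin k)

    allFin↭covered++uncovered : ∀ T → allFin k ↭ coveredVertices T ++ uncovered T
    allFin↭covered++uncovered T =
      ↭-++-complement Fin._≟_ (Unique.allFin⁺ k) (disjoint T) (λ _ → ∈-allFin _)

    uncovered⇒∉covered : ∀ T {x} → x ∈ uncovered T → x ∉ coveredVertices T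
    uncovered⇒∉covered T x∈U = proj₂ (∈-complement⁻ Fin._≟_ (coveredVertices T) (allFin k) x∈U)

    covered+uncovered≡k : ∀ T → length (coveredVertices T) + length (uncovered T) ≡ k
    covered+uncovered≡k T = begin
      length (coveredVertices T) + length (uncovered T) ≡⟨ length-++ (coveredVertices T) ⟨
      length (coveredVertices T ++ uncovered T)        ≡⟨ ↭-length (allFin↭covered++uncovered T) ⟨
      length (allFin k)                                ≡⟨ length-tabulate id ⟩
      k                                                ∎
      where open ≡-Reasoning

    heavyCovered : (∀ v → k < degree R v) → ∀ T →
      All (λ x → All (λ v → mult R x v ≤ 1) (uncovered T)) (uncovered T) → 0 < length (uncovered T) →
      Heavy (uncovered T) (coveredVertices T)
    heavyCovered δ T U-single 0<∣U∣ = +-cancelʳ-≤ (∑∑ one U U) _ _ (begin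
      suc (∑∑ one U C) + ∑∑ one U U         ≤⟨ +-monoˡ-≤ _ (+-monoˡ-≤ _ 0<∣U∣) ⟩
      length U + ∑∑ one U C + ∑∑ one U U    ≡⟨ +-assoc (length U) _ _ ⟩
      length U + (∑∑ one U C + ∑∑ one U U)  ≡⟨ cong (length U +_) (split one) ⟨
      length U + ∑∑ one U V                 ≤⟨ degrees ⟩
      ∑∑ (mult R) U V                       ≡⟨ split (mult R) ⟩
      ∑∑ (mult R) U C + ∑∑ (mult R) U U     ≤⟨ +-monoʳ-≤ _ (∑∑-mono U-single) ⟩
      ∑∑ (mult R) U C + ∑∑ one U U          ∎)
      where
      open ≤-Reasoning
      V = allFin k
      C = coveredVertices T
      U = uncovered T
      one : Fin k → Fin k → ℕ
      one _ _ = 1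
      split : ∀ w → ∑∑ w U V ≡ ∑∑ w U C + ∑∑ w U U
      split w = trans (∑∑-↭ʳ w U (allFin↭covered++uncovered T)) (∑∑-++ʳ w U C U)
      ∣V∣≡k : sum (map (λ _ → 1) V) ≡ k
      ∣V∣≡k = trans (sum-map-1 V) (length-tabulate id)
      degrees : length U + ∑∑ one U V ≤ ∑∑ (mult R) U V
      degrees = begin
        length U + ∑∑ one U V                          ≡⟨ sum-map-suc _ U ⟨
        sum (map (λ _ → suc (sum (map (λ _ → 1) V))) U) ≡⟨ cong (λ n → sum (map (λ _ → suc n) U)) ∣V∣≡k ⟩
        sum (map (λ _ → suc k) U)                      ≤⟨ sum-map-mono {xs = U} (All.tabulate (λ _ → δ _)) ⟩
        ∑∑ (mult R) U V                                ∎

    heavyTile : ∀ {U} ts → Heavy U (vertices ts) → Any (λ t → Heavy U (tileVertices t)) ts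
    heavyTile {U} ts heavy = pigeonhole _ _ ts
      (subst₂ _<_ (∑∑-concatMapʳ _ U tileVertices ts) (∑∑-concatMapʳ _ U tileVertices ts) heavy)

    augment : (∀ v → k < degree R v) → (T : Tiling R) → length (coveredVertices T) + 4 ≤ k →
      Σ (Tiling R) λ T′ → length (coveredVertices T) < length (coveredVertices T′)
    augment δ T room with any? (λ x → any? (λ v → mult R x v ≟ 2) U) U
      where
      U = uncovered T
    ... | yes double∈U =
      let x , x∈U , x∼U = find double∈U
          v , v∈U , xv   = find x∼U
      in retile T [] [] (tiles T) refl (addDoubleEdge (uncovered⇒∉covered T) x∈U v∈U xv)
    ... | no no-double∈U =
      let t , t∈T , heavy = find (heavyTile {U} (tiles T) (heavyCovered δ T U-single (≤-trans z<s 4≤∣U∣)))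
          P , Q , T≡PtQ   = ∈-∃++ t∈T
      in retile T P [ t ] Q T≡PtQ
           (retileHeavyTile (uncovered⇒∉covered T) U! 4≤∣U∣ t (All.lookup (valid T) t∈T)
             (λ v∈t → ∈-concatMap⁺ tileVertices (lose t∈T v∈t)) heavy)
      where
      U = uncovered T
      U! : Unique U
      U! = Unique.filter⁺ _ (Unique.allFin⁺ k)
      4≤∣U∣ : 4 ≤ length U
      4≤∣U∣ = +-cancelˡ-≤ (length (coveredVertices T)) 4 _
        (subst (length (coveredVertices T) + 4 ≤_) (sym (covered+uncovered≡k T)) room)
      U-single : All (λ x → All (λ v → mult R x v ≤ 1) U) U
      U-single = All.map
        (λ {x} x≁U → All.map (λ {v} xv≢2 → ≤2∧≢2⇒≤1 (mult≤2 R x v) xv≢2) (¬Any⇒All¬ U x≁U))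
        (¬Any⇒All¬ U no-double∈U)

    growTiling : (∀ v → k < degree R v) → ∀ n (T : Tiling R) →
      k ≤ length (coveredVertices T) + n + 3 → Σ (Tiling R) λ T′ → k ≤ length (coveredVertices T′) + 3
    growTiling δ zero    T k≤c+0+3 = T , subst (λ c → k ≤ c + 3) (+-identityʳ _) k≤c+0+3
    growTiling δ (suc n) T k≤c+n+4 with length (coveredVertices T) + 4 ≤? k
    ... | no  no-room = T , s≤s⁻¹ (subst (k <_) (+-suc (length (coveredVertices T)) 3) (≰⇒> no-room))
    ... | yes room    =
      let T′ , c<c′ = augment δ T room
      in growTiling δ n T′ (≤-trans k≤c+n+4 (+-monoˡ-≤ 3 (begin
        length (coveredVertices T) + suc n ≡⟨ +-suc (length (coveredVertices T)) n ⟩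
        suc (length (coveredVertices T)) + n ≤⟨ +-monoˡ-≤ n c<c′ ⟩
        length (coveredVertices T′) + n ∎)))
      where open ≤-Reasoning

  almostPerfectTiling : ∀ {k} (R : MultiGraph2 k) → (∀ v → k < degree R v) →
    Σ (Tiling R) λ T → k ≤ length (coveredVertices T) + 3
  almostPerfectTiling {k} R δ =
    growTiling R δ k (record { tiles = [] ; valid = [] ; disjoint = [] }) (m≤m+n k 3)

open import Data.Nat using (ℕ; _≥_)
open import Data.List using (length)
open import Data.Product using (Σ; ∃; _,_)
open import Data.Rational using (ℚ; 0ℚ; 1ℚ; _<_; _≤_; _+_; _-_; _*_)

open import Data.Nat as ℕ using (suc)
import Data.Nat.Properties as ℕ
open import Data.Nat.Coprimality as Coprime using (Coprime)
open import Data.Integer as ℤ using (+_; +[1+_]; -[1+_]; +≤+; +<+)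
import Data.Integer.Properties as ℤ
open import Data.Rational using (mkℚ; -_; *≤*; *<*; toℚᵘ)
open import Data.Rational.Properties
import Data.Rational.Unnormalised as ℚᵘ
import Data.Rational.Unnormalised.Properties as ℚᵘ
open import Relation.Binary.PropositionalEquality

open Tilings using (almostPerfectTiling)

ℕtoℚ-mkℚ : ∀ n → ℕtoℚ n ≡ mkℚ (+ n) 0 (Coprime.sym (Coprime.1-coprimeTo n))
ℕtoℚ-mkℚ n = normalize-coprime _

ℕtoℚ-mono-≤ : ∀ {m n} → m ℕ.≤ n → ℕtoℚ m ≤ ℕtoℚ n
ℕtoℚ-mono-≤ {m} {n} m≤n rewrite ℕtoℚ-mkℚ m | ℕtoℚ-mkℚ n =
  *≤* (subst₂ ℤ._≤_ (sym (ℤ.*-identityʳ (+ m))) (sym (ℤ.*-identityʳ (+ n))) (+≤+ m≤n))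

ℕtoℚ-cancel-< : ∀ {m n} → ℕtoℚ m < ℕtoℚ n → m ℕ.< n
ℕtoℚ-cancel-< {m} {n} m<n rewrite ℕtoℚ-mkℚ m | ℕtoℚ-mkℚ n =
  ℤ.drop‿+<+ (subst₂ ℤ._<_ (ℤ.*-identityʳ (+ m)) (ℤ.*-identityʳ (+ n)) (drop-*<* m<n))

toℚᵘ-ℕtoℚ : ∀ n → toℚᵘ (ℕtoℚ n) ℚᵘ.≃ ℚᵘ.mkℚᵘ (+ n) 0
toℚᵘ-ℕtoℚ n = toℚᵘ-fromℚᵘ (ℚᵘ.mkℚᵘ (+ n) 0)

ℕtoℚ-+ : ∀ m n → ℕtoℚ (m ℕ.+ n) ≡ ℕtoℚ m + ℕtoℚ n
ℕtoℚ-+ m n = toℚᵘ-injective (begin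
  toℚᵘ (ℕtoℚ (m ℕ.+ n))                     ≈⟨ toℚᵘ-ℕtoℚ (m ℕ.+ n) ⟩
  ℚᵘ.mkℚᵘ (+ (m ℕ.+ n)) 0                   ≈⟨ ℚᵘ.*≡* (cong (ℤ._* + 1) m+n≡) ⟩
  ℚᵘ.mkℚᵘ (+ m) 0 ℚᵘ.+ ℚᵘ.mkℚᵘ (+ n) 0      ≈⟨ ℚᵘ.+-cong (toℚᵘ-ℕtoℚ m) (toℚᵘ-ℕtoℚ n) ⟨
  toℚᵘ (ℕtoℚ m) ℚᵘ.+ toℚᵘ (ℕtoℚ n)          ≈⟨ toℚᵘ-homo-+ (ℕtoℚ m) (ℕtoℚ n) ⟨
  toℚᵘ (ℕtoℚ m + ℕtoℚ n)                    ∎)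
  where
  open ℚᵘ.≃-Reasoning
  m+n≡ : + (m ℕ.+ n) ≡ + m ℤ.* + 1 ℤ.+ + n ℤ.* + 1
  m+n≡ = trans (ℤ.pos-+ m n) (sym (cong₂ ℤ._+_ (ℤ.*-identityʳ (+ m)) (ℤ.*-identityʳ (+ n))))

ℕtoℚ-* : ∀ m n → ℕtoℚ (m ℕ.* n) ≡ ℕtoℚ m * ℕtoℚ n
ℕtoℚ-* m n = toℚᵘ-injective (begin
  toℚᵘ (ℕtoℚ (m ℕ.* n))                     ≈⟨ toℚᵘ-ℕtoℚ (m ℕ.* n) ⟩
  ℚᵘ.mkℚᵘ (+ (m ℕ.* n)) 0                   ≈⟨ ℚᵘ.*≡* (cong (ℤ._* + 1) (ℤ.pos-* m n)) ⟩
  ℚᵘ.mkℚᵘ (+ m) 0 ℚᵘ.* ℚᵘ.mkℚᵘ (+ n) 0      ≈⟨ ℚᵘ.*-cong (toℚᵘ-ℕtoℚ m) (toℚᵘ-ℕtoℚ n) ⟨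
  toℚᵘ (ℕtoℚ m) ℚᵘ.* toℚᵘ (ℕtoℚ n)          ≈⟨ toℚᵘ-homo-* (ℕtoℚ m) (ℕtoℚ n) ⟨
  toℚᵘ (ℕtoℚ m * ℕtoℚ n)                    ∎)
  where open ℚᵘ.≃-Reasoning

denominator*≡numerator : ∀ p q .(c : Coprime (suc p) (suc q)) →
  ℕtoℚ (suc q) * mkℚ +[1+ p ] q c ≡ ℕtoℚ (suc p)
denominator*≡numerator p q c = toℚᵘ-injective (begin
  toℚᵘ (ℕtoℚ (suc q) * η)                  ≈⟨ toℚᵘ-homo-* (ℕtoℚ (suc q)) η ⟩
  toℚᵘ (ℕtoℚ (suc q)) ℚᵘ.* toℚᵘ η          ≈⟨ ℚᵘ.*-congʳ {toℚᵘ η} (toℚᵘ-ℕtoℚ (suc q)) ⟩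
  ℚᵘ.mkℚᵘ (+ suc q) 0 ℚᵘ.* toℚᵘ η          ≈⟨ ℚᵘ.*≡* cross-multiplied ⟩
  ℚᵘ.mkℚᵘ (+ suc p) 0                      ≈⟨ toℚᵘ-ℕtoℚ (suc p) ⟨
  toℚᵘ (ℕtoℚ (suc p))                      ∎)
  where
  open ℚᵘ.≃-Reasoning
  η = mkℚ +[1+ p ] q c
  cross-multiplied : (+ suc q ℤ.* +[1+ p ]) ℤ.* + 1 ≡ +[1+ p ] ℤ.* + (1 ℕ.* suc q)
  cross-multiplied = trans (ℤ.*-identityʳ _)
    (trans (ℤ.*-comm (+ suc q) +[1+ p ]) (cong (λ n → +[1+ p ] ℤ.* + n) (sym (ℕ.*-identityˡ (suc q)))))

archimedean : ∀ {η} → 0ℚ < η → ∃ λ d → ∀ n k → n ℕ.* d ℕ.≤ k → ℕtoℚ n ≤ η * ℕtoℚ k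
archimedean {mkℚ +[1+ p ] q c} _ = suc q , λ n k nd≤k → begin
  ℕtoℚ n                             ≤⟨ ℕtoℚ-mono-≤ (ℕ.m≤m*n n (suc p)) ⟩
  ℕtoℚ (n ℕ.* suc p)                 ≡⟨ ℕtoℚ-* n (suc p) ⟩
  ℕtoℚ n * ℕtoℚ (suc p)              ≡⟨ cong (ℕtoℚ n *_) (denominator*≡numerator p q c) ⟨
  ℕtoℚ n * (ℕtoℚ (suc q) * η)        ≡⟨ *-assoc (ℕtoℚ n) (ℕtoℚ (suc q)) η ⟨
  ℕtoℚ n * ℕtoℚ (suc q) * η          ≡⟨ cong (_* η) (ℕtoℚ-* n (suc q)) ⟨
  ℕtoℚ (n ℕ.* suc q) * η             ≤⟨ *-monoʳ-≤-nonNeg η (ℕtoℚ-mono-≤ nd≤k) ⟩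
  ℕtoℚ k * η                         ≡⟨ *-comm (ℕtoℚ k) η ⟩
  η * ℕtoℚ k                         ∎
  where
  open ≤-Reasoning
  η = mkℚ +[1+ p ] q c
archimedean {mkℚ (+ 0)     _ _} (*<* (+<+ ()))
archimedean {mkℚ -[1+ _ ] _ _} (*<* ())

[1+μ]ℕtoℚ≤ℕtoℚ⇒< : ∀ {μ k d} → 0ℚ < μ → (1ℚ + μ) * ℕtoℚ (suc k) ≤ ℕtoℚ d → suc k ℕ.< d
[1+μ]ℕtoℚ≤ℕtoℚ⇒< {μ} {k} 0<μ [1+μ]K≤d = ℕtoℚ-cancel-< (<-≤-trans K<[1+μ]K [1+μ]K≤d)
  where
  K = ℕtoℚ (suc k)
  instance _ = normalize-pos (suc k) 1
  K<[1+μ]K : K < (1ℚ + μ) * K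
  K<[1+μ]K = begin-strict
    K                 ≡⟨ +-identityʳ K ⟨
    K + 0ℚ            ≡⟨ cong (_+_ K) (*-zeroˡ K) ⟨
    K + 0ℚ * K        <⟨ +-monoʳ-< K (*-monoˡ-<-pos K 0<μ) ⟩
    K + μ * K         ≡⟨ cong (_+ μ * K) (*-identityˡ K) ⟨
    1ℚ * K + μ * K    ≡⟨ *-distribʳ-+ K 1ℚ μ ⟨
    (1ℚ + μ) * K      ∎
    where open ≤-Reasoning

p≤q+r⇒p-q≤r : ∀ {p q r} → p ≤ q + r → p - q ≤ r
p≤q+r⇒p-q≤r {p} {q} {r} p≤q+r = begin
  p - q             ≤⟨ +-monoˡ-≤ (- q) p≤q+r ⟩
  q + r - q         ≡⟨ cong (_- q) (+-comm q r) ⟩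
  r + q - q         ≡⟨ +-assoc r q (- q) ⟩
  r + (q - q)       ≡⟨ cong (_+_ r) (+-inverseʳ q) ⟩
  r + 0ℚ            ≡⟨ +-identityʳ r ⟩
  r                 ∎
  where open ≤-Reasoning

ℕtoℚ-difference≤ : ∀ η {k} c n → k ℕ.≤ c ℕ.+ n → ℕtoℚ n ≤ η * ℕtoℚ k →
  ℕtoℚ k - ℕtoℚ c ≤ η * ℕtoℚ k
ℕtoℚ-difference≤ η {k} c n k≤c+n n≤ηk = p≤q+r⇒p-q≤r (begin
  ℕtoℚ k                  ≤⟨ ℕtoℚ-mono-≤ k≤c+n ⟩
  ℕtoℚ (c ℕ.+ n)          ≡⟨ ℕtoℚ-+ c n ⟩
  ℕtoℚ c + ℕtoℚ n         ≤⟨ +-monoʳ-≤ (ℕtoℚ c) n≤ηk ⟩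
  ℕtoℚ c + η * ℕtoℚ k     ∎)
  where open ≤-Reasoning

minDegree⇒k<degree : ∀ {k μ} (R : MultiGraph2 k) → 0ℚ < μ →
  MinDegreeAtLeast R ((1ℚ + μ) * ℕtoℚ k) → ∀ v → k ℕ.< degree R v
minDegree⇒k<degree {suc k} R 0<μ δ v = [1+μ]ℕtoℚ≤ℕtoℚ⇒< 0<μ (δ v)

lemma4p1 : (η μ : ℚ) → 0ℚ < η → η < 1ℚ → 0ℚ < μ → μ < 1ℚ →
    ∃ λ (k₀ : ℕ) → ∀ (k : ℕ) → k ≥ k₀ →
      (R : MultiGraph2 k) → MinDegreeAtLeast R ((1ℚ + μ) * ℕtoℚ k) →
      Σ (Tiling R) λ T →
        ℕtoℚ k - ℕtoℚ (length (coveredVertices T)) ≤ η * ℕtoℚ k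
lemma4p1 η μ 0<η _ 0<μ _ =
  let d , n≤ηk = archimedean 0<η in
  3 ℕ.* d , λ k 3d≤k R δ →
    let T , k≤c+3 = almostPerfectTiling R (minDegree⇒k<degree R 0<μ δ) in
    T , ℕtoℚ-difference≤ η (length (coveredVertices T)) 3 k≤c+3 (n≤ηk 3 k 3d≤k)
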